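{- In the setting below, if $(\mathcal{W},X)$ is a maximal wave and $v\in X$, then there is a $v\rightarrow t$ path $Q$ in the induced subdigraph $D[X]$ such that $A(\mathcal{W})\cup A(Q)$ is independent in $\mathcal{M}$.
   Context: Setting: $D=(V,A)$ is a countable digraph (multiple edges and loops allowed), $s\neq t\in V$; for each $v\in V$, $\mathcal{M}_v$ is a finitary matroid on the set $\mathsf{in}_D(v)$ of edges with head $v$, and $\mathcal{M}=\bigoplus_{v}\mathcal{M}_v$ is assumed to have no loops. Paths are finite directed paths without repeated vertices; a $v\rightarrow t$ path is a path from $v$ to $t$ (the trivial path if $v=t$). For $X\subseteq V$, $\mathsf{in}_D(X)$ is the set of edges entering $X$. A path $P$ is an $s\rightarrow X$ path if $V(P)\cap\{s\}=\{\mathsf{start}(P)\}$ and $V(P)\cap X=\{\mathsf{end}(P)\}$. For a path system $\mathcal{W}$, $A(\mathcal{W})$ is the union of edge sets and $A_{last}(\mathcal{W})$ the set of last edges; $\mathcal{W}$ is independent if $A(\mathcal{W})$ is $\mathcal{M}$-independent. A $t-s$ cut is a set $X$ with $t\in X\subseteq V\setminus\{s\}$. A wave is a pair $(\mathcal{W},X)$ with $X$ a $t-s$ cut and $\mathcal{W}$ an independent system of pairwise edge-disjoint $s\rightarrow X$ paths such that $A_{last}(\mathcal{W})$ spans $\mathsf{in}_D(X)$ in $\mathcal{M}$. A forward continuation of a path $P$ is a path having $P$ as an initial segment (possibly $P$ itself). $(\mathcal{W}_0,X_0)\leq(\mathcal{W}_1,X_1)$ means: $X_1\subseteq X_0$;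 every path of $\mathcal{W}_1$ is a forward continuation of some path of $\mathcal{W}_0$ with the added terminal segment lying in $X_0$; and $\mathcal{W}_1$ contains every path of $\mathcal{W}_0$ meeting $X_1$. A wave is maximal if no wave is strictly greater in $\leq$. -}

module Defs where

open import Level using (0ℓ)
open import Data.Nat using (ℕ)
open import Data.Maybe using (Maybe; just; nothing)
open import Data.List using (List; []; _∷_)
open import Data.List.Membership.Propositional renaming (_∈_ to _∈ₗ_)
open import Data.List.Relation.Unary.All using (All)
open import Data.List.Relation.Unary.Unique.Propositional using (Unique)
open import Data.Product using (Σ; ∃; _×_; _,_; proj₁)
open import Data.Sum using (_⊎_)
open import Relation.Nullary using (¬_)
open import Relation.Unary using (Pred; _⊆_; _∪_; ∅; ｛_｝)
open import Relation.Binary.PropositionalEquality using (_≡_; _≢_)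
open import Function.Definitions using (Injective)
open import Function.Bundles using (_⇔_)

Countable : Set → Set
Countable X = Σ (X → ℕ) (λ f → Injective _≡_ _≡_ f)

-- Matroids (infinite matroid axioms of Bruhn et al.), given by
-- the independence predicate on subsets of the ground type E.

module _ {E : Set} (Indep : Pred (Pred E 0ℓ) 0ℓ) where

  IsBase : Pred E 0ℓ → Set₁
  IsBase B = Indep B × (∀ J → Indep J → B ⊆ J → J ⊆ B)

  -- S spans T (T ⊆ cl(S)): every element of T lies in S or
  -- creates a circuit with some independent subset of S
  Spans : Pred E 0ℓ → Pred E 0ℓ → Set₁
  Spans S T = ∀ e → T e →
    S e ⊎ Σ (Pred E 0ℓ) (λ I → I ⊆ S × Indep I × ¬ Indep (I ∪ ｛ e ｝))

record Matroid (E : Set) : Set₁ where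
  field
    Indep : Pred (Pred E 0ℓ) 0ℓ
    I1 : Indep ∅
    I2 : ∀ {I J : Pred E 0ℓ} → Indep J → I ⊆ J → Indep I
    I3 : ∀ {I J : Pred E 0ℓ} → Indep I → ¬ IsBase Indep I → IsBase Indep J →
         Σ E (λ x → J x × ¬ I x × Indep (I ∪ ｛ x ｝))
    IM : ∀ {I X : Pred E 0ℓ} → Indep I → I ⊆ X →
         Σ (Pred E 0ℓ) (λ J → I ⊆ J × J ⊆ X × Indep J ×
           (∀ J′ → Indep J′ → J ⊆ J′ → J′ ⊆ X → J′ ⊆ J))
open Matroid public

Finitary : {E : Set} → Matroid E → Set₁
Finitary {E} M = ∀ (I : Pred E 0ℓ) →
  Indep M I ⇔ (∀ (xs : List E) → (∀ x → x ∈ₗ xs → I x) → Indep M (λ x → x ∈ₗ xs))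

record Digraph : Set₁ where
  field
    Vtx  : Set
    Edge : Set
    tl   : Edge → Vtx
    hd   : Edge → Vtx
open Digraph public

CountableDigraph : Digraph → Set
CountableDigraph D = Countable (Vtx D) × Countable (Edge D)

InEdge : (D : Digraph) → Vtx D → Set
InEdge D v = Σ (Edge D) (λ e → hd D e ≡ v)

inD : (D : Digraph) → Pred (Vtx D) 0ℓ → Pred (Edge D) 0ℓ
inD D X e = X (hd D e) × ¬ X (tl D e)

⊕Indep : (D : Digraph) → ((v : Vtx D) → Matroid (InEdge D v)) →
         Pred (Pred (Edge D) 0ℓ) 0ℓ
⊕Indep D Ms I = ∀ v → Indep (Ms v) (λ ev → I (proj₁ ev))

Loopless : (D : Digraph) → Pred (Pred (Edge D) 0ℓ) 0ℓ → Set
Loopless D IM = ∀ e → IM ｛ e ｝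

data Walk (D : Digraph) : Vtx D → Vtx D → Set where
  nil  : ∀ {v} → Walk D v v
  cons : ∀ {u w} (e : Edge D) → tl D e ≡ u → Walk D (hd D e) w → Walk D u w

module _ {D : Digraph} where

  verts : ∀ {u w} → Walk D u w → List (Vtx D)
  verts {u} nil = u ∷ []
  verts {u} (cons e _ p) = u ∷ verts p

  edges : ∀ {u w} → Walk D u w → List (Edge D)
  edges nil = []
  edges (cons e _ p) = e ∷ edges p

  lastEdge : ∀ {u w} → Walk D u w → Maybe (Edge D)
  lastEdge nil = nothing
  lastEdge (cons e _ nil) = just e
  lastEdge (cons e _ p@(cons _ _ _)) = lastEdge p

  _++ᵂ_ : ∀ {u w z} → Walk D u w → Walk D w z → Walk D u z
  nil ++ᵂ q = q
  cons e eq p ++ᵂ q = cons e eq (p ++ᵂ q)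

  edgeSet : ∀ {u w} → Walk D u w → Pred (Edge D) 0ℓ
  edgeSet p e = e ∈ₗ edges p

record Path (D : Digraph) : Set where
  constructor path
  field
    start : Vtx D
    end   : Vtx D
    walk  : Walk D start end
open Path public

IsPath : {D : Digraph} → Path D → Set
IsPath P = Unique (verts (walk P))

PathSystem : Digraph → Set₁
PathSystem D = Pred (Path D) 0ℓ

module _ {D : Digraph} where

  A𝒲 : PathSystem D → Pred (Edge D) 0ℓ
  A𝒲 W e = Σ (Path D) (λ P → W P × e ∈ₗ edges (walk P))

  Alast : PathSystem D → Pred (Edge D) 0ℓ
  Alast W e = Σ (Path D) (λ P → W P × lastEdge (walk P) ≡ just e)

  IsSXPath : Vtx D → Pred (Vtx D) 0ℓ → Path D → Set
  IsSXPath s X P =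
    IsPath P ×
    (∀ v → (v ∈ₗ verts (walk P) × v ≡ s) ⇔ (v ≡ start P)) ×
    (∀ v → (v ∈ₗ verts (walk P) × X v) ⇔ (v ≡ end P))

  IsCut : Vtx D → Vtx D → Pred (Vtx D) 0ℓ → Set
  IsCut t s X = X t × ¬ X s

  IsWave : Pred (Pred (Edge D) 0ℓ) 0ℓ → Vtx D → Vtx D →
           PathSystem D → Pred (Vtx D) 0ℓ → Set₁
  IsWave IM s t W X =
    IsCut t s X ×
    (∀ P → W P → IsSXPath s X P) ×
    IM (A𝒲 W) ×
    (∀ P Q → W P → W Q → P ≢ Q → ∀ e → e ∈ₗ edges (walk P) → ¬ e ∈ₗ edges (walk Q)) ×
    Spans IM (Alast W) (inD D X)

  ContinuesIn : Pred (Vtx D) 0ℓ → Path D → Path D → Set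
  ContinuesIn X₀ P Q = Σ (Walk D (end P) (end Q)) (λ R →
    (Q ≡ path (start P) (end Q) (walk P ++ᵂ R)) × All X₀ (verts R))

  WaveLe : PathSystem D → Pred (Vtx D) 0ℓ → PathSystem D → Pred (Vtx D) 0ℓ → Set
  WaveLe W₀ X₀ W₁ X₁ =
    X₁ ⊆ X₀ ×
    (∀ Q → W₁ Q → Σ (Path D) (λ P → W₀ P × ContinuesIn X₀ P Q)) ×
    (∀ P → W₀ P → Σ (Vtx D) (λ v → v ∈ₗ verts (walk P) × X₁ v) → W₁ P)

  IsMaximalWave : Pred (Pred (Edge D) 0ℓ) 0ℓ → Vtx D → Vtx D →
                  PathSystem D → Pred (Vtx D) 0ℓ → Set₁
  IsMaximalWave IM s t W X =
    IsWave IM s t W X ×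
    ¬ Σ (PathSystem D) (λ W′ → Σ (Pred (Vtx D) 0ℓ) (λ X′ →
        IsWave IM s t W′ X′ × WaveLe W X W′ X′ × ¬ WaveLe W′ X′ W X))

-- Call v linked if some v → t path inside X is independent together with A(𝒲).
-- Restricting 𝒲 to the paths ending at linked vertices, together with the cut of
-- linked vertices, is again a wave above (𝒲, X). The only nontrivial point is that
-- the new last edges span every edge e entering the linked set: if tl e ∈ X, then e
-- must depend on the edges of A(𝒲) with head hd e (which are all last edges of 𝒲,
-- as X is entered only once), since otherwise prepending e to a linked path from
-- hd e would make tl e linked; if tl e ∉ X, e enters X and is spanned by A_last(𝒲).
-- Maximality then forces every vertex of X to be linked.
module Submission where

open import Defs
open import Level using (0ℓ; suc; Lift; lift; lower)
open import Axiom.ExcludedMiddle using (ExcludedMiddle)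
open import Data.List.Membership.Propositional using (_∈_)
open import Data.List.Relation.Unary.All using (All; []; _∷_)
import Data.List.Relation.Unary.All as All
open import Data.List.Relation.Unary.All.Properties using (¬Any⇒All¬)
open import Data.List.Relation.Unary.AllPairs using ([]; _∷_)
open import Data.List.Relation.Unary.Any using (here; there)
open import Data.List.Relation.Unary.Unique.Propositional using (Unique)
open import Data.Maybe using (just)
open import Data.Product using (Σ; _×_; _,_; proj₁; proj₂)
open import Data.Sum using (inj₁; inj₂)
open import Data.Empty using (⊥-elim)
open import Function.Bundles using (Equivalence; mk⇔)
open import Relation.Nullary using (¬_; Dec; yes; no)
open import Relation.Nullary.Decidable using (map′)
open import Relation.Unary using (Pred; _∪_; _⊆_; ｛_｝)
open import Relation.Binary.PropositionalEquality
  using (_≡_; _≢_; refl; sym; trans; cong; subst)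

module _ {D : Digraph} where

  start∈verts : ∀ {u w} (q : Walk D u w) → u ∈ verts q
  start∈verts nil = here refl
  start∈verts (cons _ _ _) = here refl

  end∈verts : ∀ {u w} (q : Walk D u w) → w ∈ verts q
  end∈verts nil = here refl
  end∈verts (cons _ _ q) = there (end∈verts q)

  hd∈verts : ∀ {u w f} (q : Walk D u w) → f ∈ edges q → hd D f ∈ verts q
  hd∈verts (cons _ _ q) (here refl) = there (start∈verts q)
  hd∈verts (cons _ _ q) (there f∈q) = there (hd∈verts q f∈q)

  lastEdge⇒hd≡end : ∀ {u w f} (q : Walk D u w) → lastEdge q ≡ just f → hd D f ≡ w
  lastEdge⇒hd≡end (cons _ _ nil) refl = refl
  lastEdge⇒hd≡end (cons _ _ q@(cons _ _ _)) eq = lastEdge⇒hd≡end q eq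

  Unique⇒hd≢start : ∀ {u w f} (q : Walk D u w) → Unique (verts q) →
                    f ∈ edges q → hd D f ≢ u
  Unique⇒hd≢start (cons _ _ q) (u∉q ∷ _) (here refl) h =
    All.lookup u∉q (start∈verts q) (sym h)
  Unique⇒hd≢start (cons _ _ q) (u∉q ∷ _) (there f∈q) h =
    All.lookup u∉q (hd∈verts q f∈q) (sym h)

  Unique∧hd≡end⇒lastEdge : ∀ {u w f} (q : Walk D u w) → Unique (verts q) →
                           f ∈ edges q → hd D f ≡ w → lastEdge q ≡ just f
  Unique∧hd≡end⇒lastEdge (cons _ _ nil) _ (here refl) _ = refl
  Unique∧hd≡end⇒lastEdge (cons _ _ (cons _ _ q)) (_ ∷ (u∉q ∷ _)) (here refl) h =
    ⊥-elim (All.lookup u∉q (end∈verts q) h)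
  Unique∧hd≡end⇒lastEdge (cons _ _ q@(cons _ _ _)) (_ ∷ uq) (there f∈q) h =
    Unique∧hd≡end⇒lastEdge q uq f∈q h

  ++ᵂ-identityʳ : ∀ {u w} (q : Walk D u w) → q ++ᵂ nil ≡ q
  ++ᵂ-identityʳ nil = refl
  ++ᵂ-identityʳ (cons e eq q) = cong (cons e eq) (++ᵂ-identityʳ q)

  dropTo : ∀ {u w x} (q : Walk D u w) → x ∈ verts q → Walk D x w
  dropTo nil (here refl) = nil
  dropTo q@(cons _ _ _) (here refl) = q
  dropTo (cons _ _ q) (there x∈q) = dropTo q x∈q

  All-dropTo : ∀ {u w x} {P : Pred (Vtx D) 0ℓ} (q : Walk D u w) (x∈q : x ∈ verts q) →
               All P (verts q) → All P (verts (dropTo q x∈q))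
  All-dropTo nil (here refl) ps = ps
  All-dropTo (cons _ _ _) (here refl) ps = ps
  All-dropTo (cons _ _ q) (there x∈q) (_ ∷ ps) = All-dropTo q x∈q ps

  Unique-dropTo : ∀ {u w x} (q : Walk D u w) (x∈q : x ∈ verts q) →
                  Unique (verts q) → Unique (verts (dropTo q x∈q))
  Unique-dropTo nil (here refl) uq = uq
  Unique-dropTo (cons _ _ _) (here refl) uq = uq
  Unique-dropTo (cons _ _ q) (there x∈q) (_ ∷ uq) = Unique-dropTo q x∈q uq

  edges-dropTo : ∀ {u w x} (q : Walk D u w) (x∈q : x ∈ verts q) →
                 edgeSet (dropTo q x∈q) ⊆ edgeSet q
  edges-dropTo nil (here refl) f∈q = f∈q
  edges-dropTo (cons _ _ _) (here refl) f∈q = f∈q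
  edges-dropTo (cons _ _ q) (there x∈q) f∈q = there (edges-dropTo q x∈q f∈q)

module DirectSum {D : Digraph} (Ms : (v : Vtx D) → Matroid (InEdge D v)) where

  private
    Ind : Pred (Pred (Edge D) 0ℓ) 0ℓ
    Ind = ⊕Indep D Ms

  ⊕Indep-mono : ∀ {I J} → Ind J → I ⊆ J → Ind I
  ⊕Indep-mono indJ I⊆J v = I2 (Ms v) (indJ v) I⊆J

  atHead : Pred (Edge D) 0ℓ → Vtx D → Pred (Edge D) 0ℓ
  atHead S v f = S f × hd D f ≡ v

  ⊕Indep-glue : ∀ {A B C} v → (∀ w → Dec (w ≡ v)) → Ind A → Ind B →
                (∀ {f} → C f → hd D f ≡ v → B f) →
                (∀ {f} → C f → hd D f ≢ v → A f) → Ind C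
  ⊕Indep-glue v _≟v indA indB C⊆B C⊆A w with w ≟v
  ... | yes refl = I2 (Ms v) (indB v) (λ {(_ , hf)} c → C⊆B c hf)
  ... | no  w≢v  = I2 (Ms w) (indA w) (λ {(_ , hf)} c → C⊆A c λ h → w≢v (trans (sym hf) h))

  ⊕Dependent-atHead : ∀ {I e} → (∀ w → Dec (w ≡ hd D e)) → Ind I →
                      ¬ Ind (I ∪ ｛ e ｝) → ¬ Ind (atHead I (hd D e) ∪ ｛ e ｝)
  ⊕Dependent-atHead {I} {e} _≟hd indI dep indAtHead =
    dep (⊕Indep-glue (hd D e) _≟hd indI indAtHead atHd offHd)
    where
    atHd : ∀ {f} → (I ∪ ｛ e ｝) f → hd D f ≡ hd D e → (atHead I (hd D e) ∪ ｛ e ｝) f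
    atHd (inj₁ i) hf = inj₁ (i , hf)
    atHd (inj₂ e≡f) _ = inj₂ e≡f
    offHd : ∀ {f} → (I ∪ ｛ e ｝) f → hd D f ≢ hd D e → I f
    offHd (inj₁ i) _ = i
    offHd (inj₂ refl) hf≢ = ⊥-elim (hf≢ refl)

module LinkedWave (em : ExcludedMiddle (suc 0ℓ))
  {D : Digraph} {s t : Vtx D} (Ms : (v : Vtx D) → Matroid (InEdge D v))
  {W : PathSystem D} {X : Pred (Vtx D) 0ℓ}
  (wave : IsWave (⊕Indep D Ms) s t W X) where

  open DirectSum {D} Ms

  private
    Ind : Pred (Pred (Edge D) 0ℓ) 0ℓ
    Ind = ⊕Indep D Ms

    dec : (P : Set) → Dec P
    dec P = map′ lower lift (em {Lift (suc 0ℓ) P})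

    W-cut : IsCut {D = D} t s X
    W-cut = proj₁ wave

    W-sX : ∀ P → W P → IsSXPath s X P
    W-sX = proj₁ (proj₂ wave)

    W-indep : Ind (A𝒲 W)
    W-indep = proj₁ (proj₂ (proj₂ wave))

    W-disjoint : ∀ P Q → W P → W Q → P ≢ Q → ∀ e → e ∈ edges (walk P) → ¬ e ∈ edges (walk Q)
    W-disjoint = proj₁ (proj₂ (proj₂ (proj₂ wave)))

    W-spans : Spans Ind (Alast W) (inD D X)
    W-spans = proj₂ (proj₂ (proj₂ (proj₂ wave)))

  Linked : Pred (Vtx D) 0ℓ
  Linked v = Σ (Walk D v t) (λ Q → Unique (verts Q) × All X (verts Q) × Ind (A𝒲 W ∪ edgeSet Q))

  Linked⇒X : ∀ {v} → Linked v → X v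
  Linked⇒X (nil , _ , xv ∷ _ , _) = xv
  Linked⇒X (cons _ _ _ , _ , xv ∷ _ , _) = xv

  Linked-t : Linked t
  Linked-t = nil , [] ∷ [] , proj₁ W-cut ∷ [] , ⊕Indep-mono W-indep λ { (inj₁ a) → a ; (inj₂ ()) }

  X-edge-is-last : ∀ {P f} → W P → f ∈ edges (walk P) → X (hd D f) →
                   lastEdge (walk P) ≡ just f × hd D f ≡ end P
  X-edge-is-last {P} {f} P∈W f∈P xf with W-sX P P∈W
  ... | uP , _ , meetsX =
    let hf≡end = Equivalence.to (meetsX (hd D f)) (hd∈verts (walk P) f∈P , xf)
    in Unique∧hd≡end⇒lastEdge (walk P) uP f∈P hf≡end , hf≡end

  Linked-prepend : ∀ {e} → X (tl D e) → Linked (hd D e) →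
                   Ind (atHead (A𝒲 W) (hd D e) ∪ ｛ e ｝) → Linked (tl D e)
  Linked-prepend {e} xt (Q , uQ , xQ , indQ) ind with dec (tl D e ∈ verts Q)
  ... | yes tl∈Q = dropTo Q tl∈Q , Unique-dropTo Q tl∈Q uQ , All-dropTo Q tl∈Q xQ
                 , ⊕Indep-mono indQ λ { (inj₁ a) → inj₁ a
                                      ; (inj₂ f∈) → inj₂ (edges-dropTo Q tl∈Q f∈) }
  ... | no  tl∉Q = cons e refl Q , ¬Any⇒All¬ (verts Q) tl∉Q ∷ uQ , xt ∷ xQ
                 , ⊕Indep-glue (hd D e) (λ w → dec (w ≡ hd D e)) indQ ind atHd offHd
    where
    atHd : ∀ {f} → (A𝒲 W ∪ edgeSet (cons e refl Q)) f → hd D f ≡ hd D e →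
           (atHead (A𝒲 W) (hd D e) ∪ ｛ e ｝) f
    atHd (inj₁ a) hf = inj₁ (a , hf)
    atHd (inj₂ (here refl)) _ = inj₂ refl
    atHd (inj₂ (there f∈Q)) hf = ⊥-elim (Unique⇒hd≢start Q uQ f∈Q hf)
    offHd : ∀ {f} → (A𝒲 W ∪ edgeSet (cons e refl Q)) f → hd D f ≢ hd D e →
            (A𝒲 W ∪ edgeSet Q) f
    offHd (inj₁ a) _ = inj₁ a
    offHd (inj₂ (here refl)) hf≢ = ⊥-elim (hf≢ refl)
    offHd (inj₂ (there f∈Q)) _ = inj₂ f∈Q

  W↾Linked : PathSystem D
  W↾Linked P = W P × Linked (end P)

  private
    lastEdges-at : ∀ {e I} → Linked (hd D e) → atHead I (hd D e) ⊆ Alast W →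
                   atHead I (hd D e) ⊆ Alast W↾Linked
    lastEdges-at lh I⊆ (i , hf) with I⊆ (i , hf)
    ... | P , P∈W , last≡f =
      P , (P∈W , subst Linked (trans (sym hf) (lastEdge⇒hd≡end (walk P) last≡f)) lh) , last≡f

    A𝒲-at⊆Alast : ∀ {e} → Linked (hd D e) → atHead (A𝒲 W) (hd D e) ⊆ Alast W
    A𝒲-at⊆Alast lh ((P , P∈W , f∈P) , hf) =
      P , P∈W , proj₁ (X-edge-is-last P∈W f∈P (subst X (sym hf) (Linked⇒X lh)))

  W↾Linked-spans : Spans Ind (Alast W↾Linked) (inD D Linked)
  W↾Linked-spans e (lh , ¬lt) with dec (X (tl D e))
  ... | yes xt = inj₂ (atHead (A𝒲 W) (hd D e) , lastEdges-at lh (A𝒲-at⊆Alast lh)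
                      , ⊕Indep-mono W-indep proj₁ , λ ind → ¬lt (Linked-prepend xt lh ind))
  ... | no ¬xt with W-spans e (Linked⇒X lh , ¬xt)
  ...   | inj₁ (P , P∈W , last≡e) =
          inj₁ (P , (P∈W , subst Linked (lastEdge⇒hd≡end (walk P) last≡e) lh) , last≡e)
  ...   | inj₂ (I , I⊆ , indI , dep) =
          inj₂ (atHead I (hd D e) , lastEdges-at lh (λ (i , _) → I⊆ i) , ⊕Indep-mono indI proj₁
               , ⊕Dependent-atHead (λ w → dec (w ≡ hd D e)) indI dep)

  W↾Linked-wave : IsWave Ind s t W↾Linked Linked
  W↾Linked-wave =
      (Linked-t , λ ls → proj₂ W-cut (Linked⇒X ls))
    , sX
    , ⊕Indep-mono W-indep (λ { (P , (P∈W , _) , f∈P) → P , P∈W , f∈P })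
    , (λ P Q P∈ Q∈ → W-disjoint P Q (proj₁ P∈) (proj₁ Q∈))
    , W↾Linked-spans
    where
    sX : ∀ P → W↾Linked P → IsSXPath s Linked P
    sX P (P∈W , lEnd) with W-sX P P∈W
    ... | uP , meetsS , meetsX =
      uP , meetsS , λ v → mk⇔ (λ (v∈P , lv) → Equivalence.to (meetsX v) (v∈P , Linked⇒X lv))
                               (λ { refl → end∈verts (walk P) , lEnd })

  W≤W↾Linked : WaveLe W X W↾Linked Linked
  W≤W↾Linked =
      Linked⇒X
    , (λ Q (Q∈W , lEnd) → Q , Q∈W , nil
                        , cong (path (start Q) (end Q)) (sym (++ᵂ-identityʳ (walk Q)))
                        , Linked⇒X lEnd ∷ [])
    , λ P P∈W (u , u∈P , lu) →
        let u≡end = Equivalence.to (proj₂ (proj₂ (W-sX P P∈W)) u) (u∈P , Linked⇒X lu)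
        in P∈W , subst Linked u≡end lu

  maximal⇒Linked : (¬ Σ (PathSystem D) λ W′ → Σ (Pred (Vtx D) 0ℓ) λ X′ →
                      IsWave Ind s t W′ X′ × WaveLe W X W′ X′ × ¬ WaveLe W′ X′ W X) →
                   X ⊆ Linked
  maximal⇒Linked notSmaller {v} xv with dec (Linked v)
  ... | yes lv = lv
  ... | no ¬lv = ⊥-elim (notSmaller (W↾Linked , Linked , W↾Linked-wave , W≤W↾Linked
                                    , λ le → ¬lv (proj₁ le xv)))

proposition14 : ExcludedMiddle (suc 0ℓ) →
    (D : Digraph) → CountableDigraph D →
    (s t : Vtx D) → s ≢ t →
    (Ms : (v : Vtx D) → Matroid (InEdge D v)) → (∀ v → Finitary (Ms v)) →
    Loopless D (⊕Indep D Ms) →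
    (W : PathSystem D) (X : Pred (Vtx D) 0ℓ) →
    IsMaximalWave (⊕Indep D Ms) s t W X →
    (v : Vtx D) → X v →
    Σ (Walk D v t) (λ Q →
      Unique (verts Q) × All X (verts Q) × ⊕Indep D Ms (A𝒲 W ∪ edgeSet Q))
proposition14 em D _ s t _ Ms _ _ W X (wave , notSmaller) v xv =
  LinkedWave.maximal⇒Linked em Ms wave notSmaller xv
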